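{- Let $X$ be a finite nonempty linearly ordered set, let $C$ be a simplicial complex with $\emptyset\ne\bigcup C\subseteq TX$ such that $\kappa_X$ faithfully realizes $C$, and let $B$ be a building set of $C$. Then there exist $\beta_1,\ldots,\beta_m\in B$ such that $\mathrm{Sb}_X(C,B)=\mathrm{Bl}_{\beta_1}(\ldots\mathrm{Bl}_{\beta_m}\,C)$.
   Context: A simplicial complex is a set $C=P(\alpha_1)\cup\ldots\cup P(\alpha_k)$, $k\ge1$, with $P(\cdot)$ the power set and the $\alpha_i$ finite pairwise $\subseteq$-incomparable sets (bases). For a family $B$ and set $\beta$, $B_\beta=B\cap P(\beta)$. A building set of $P(\gamma)$ ($\gamma$ finite) is a set $B$ of nonempty subsets of $\gamma$ with (B1) $\beta,\delta\in B$, $\beta\cap\delta\ne\emptyset$ imply $\beta\cup\delta\in B$, (B2) $\{a\}\in B$ for $a\in\gamma$. A building set of $C$ with bases $\alpha_i$ is $B\subseteq C$ with every $B_{\alpha_i}$ a building set of $P(\alpha_i)$. An $N$-antichain is a set of at least two pairwise $\subseteq$-incomparable members of $N$. $N\subseteq B$ is nested if for every $N$-antichain $\{\beta_1,\ldots,\beta_t\}$, $\beta_1\cup\ldots\cup\beta_t\in C-B$; $\widetilde{\mathcal N}(C,B)$ is the simplicial complex of nested subsets of $B$. $TX$ is the free commutative semigroup generated by $X$ (formal sums $\sum_jk_jx_j$, positive integer coefficients). If $X=\{x_1<\ldots<x_d\}$, $\kappa_X:TX\to\mathbb R^d$ sends $\sum_jk_jx_j$ to $(k_1,\ldots,k_d)$.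 A function $f$ into $\mathbb R^d$ faithfully realizes a simplicial complex $E$ if for all $\alpha,\beta\in E$ and positive reals $k_a,l_b$, $\sum_{a\in\alpha}k_af(a)=\sum_{b\in\beta}l_bf(b)$ implies $\alpha=\beta$ and $k_a=l_a$. For finite nonempty $\gamma\subseteq TX$, $\gamma^+\in TX$ is the sum in $TX$ of the elements of $\gamma$, and $[N]^+=\{\gamma^+\mid\gamma\in N\}$. $\mathrm{Sb}_X(C,B)=\{[N]^+\mid N\in\widetilde{\mathcal N}(C,B)\}$. For a simplicial complex $E$ with $\bigcup E\subseteq TX$ and a finite nonempty $\alpha\subseteq TX$, $\mathrm{Bl}_\alpha E=\{\gamma\in E\mid\alpha\not\subseteq\gamma\}\cup\{\gamma\cup\{\alpha^+\}\mid\alpha\not\subseteq\gamma\text{ and }\alpha\cup\gamma\in E\}$. -}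

module Defs where

open import Data.Nat using (ℕ; suc; _≤_)
import Data.Nat as ℕ
open import Data.Integer using (+_)
open import Data.Rational using (ℚ; 0ℚ; _<_; _/_)
import Data.Rational as ℚ
open import Data.Vec using (Vec; zipWith; replicate)
import Data.Vec as Vec
open import Data.Vec.Properties using (≡-dec)
open import Data.List using (List; []; _∷_; length; concat; deduplicate; foldr)
import Data.List as List
open import Data.List.Membership.Propositional using (_∈_)
open import Data.List.Relation.Binary.Subset.Propositional using (_⊆_)
open import Data.List.Relation.Unary.Any using (Any)
open import Data.List.Relation.Unary.All using (All)
open import Data.List.Relation.Unary.AllPairs using (AllPairs)
open import Data.Product using (_×_; Σ; ∃; ∃-syntax)
open import Data.Sum using (_⊎_)
open import Relation.Nullary using (¬_)
open import Relation.Binary.PropositionalEquality using (_≡_; _≢_)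

-- The linearly ordered set X = {x_1 < ... < x_d} is Fin d (d = suc n).
-- The free commutative semigroup TX is identified, via κ_X, with the
-- nonzero vectors of Vec ℕ d (a formal sum Σ k_j x_j ↦ (k_1,…,k_d)).

Vtx : ℕ → Set
Vtx d = Vec ℕ d

InT : ∀ {d} → Vtx d → Set
InT {d} v = v ≢ replicate d 0

_⊕_ : ∀ {d} → Vtx d → Vtx d → Vtx d
_⊕_ = zipWith ℕ._+_

-- finite sets of points of TX, represented by lists (duplicates and
-- order are irrelevant: all notions below are invariant under having
-- the same members)
FSet : ℕ → Set
FSet d = List (Vtx d)

Family : ℕ → Set₁
Family d = FSet d → Set

_≈_ : ∀ {d} → FSet d → FSet d → Set
α ≈ β = α ⊆ β × β ⊆ α

_∈F_ : ∀ {d} → FSet d → List (FSet d) → Set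
γ ∈F B = Any (λ β → γ ≈ β) B

dedup : ∀ {d} → FSet d → FSet d
dedup = deduplicate (≡-dec ℕ._≟_)

_⁺ : ∀ {d} → FSet d → Vtx d
_⁺ {d} γ = foldr _⊕_ (replicate d 0) (dedup γ)

-- Simplicial complexes, given by their list of bases α_1,…,α_k

record IsComplexBases {d} (bs : List (FSet d)) : Set where
  field
    nonemptyBases : bs ≢ []
    incomparable  : AllPairs (λ α β → ¬ (α ⊆ β) × ¬ (β ⊆ α)) bs

InC : ∀ {d} → List (FSet d) → Family d
InC bs γ = Any (λ α → γ ⊆ α) bs

UnionNonempty : ∀ {d} → List (FSet d) → Set
UnionNonempty {d} bs = Σ (Vtx d) λ a → Any (λ α → a ∈ α) bs

UnionInT : ∀ {d} → List (FSet d) → Set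
UnionInT bs = All (λ α → All InT α) bs

ℕtoℚ : ℕ → ℚ
ℕtoℚ n = + n / 1

κ : ∀ {d} → Vtx d → Vec ℚ d
κ = Vec.map ℕtoℚ

lincomb : ∀ {d} → (Vtx d → ℚ) → FSet d → Vec ℚ d
lincomb {d} k α =
  foldr (λ a acc → zipWith ℚ._+_ (Vec.map (k a ℚ.*_) (κ a)) acc)
        (replicate d 0ℚ) (dedup α)

FaithfullyRealizesκ : ∀ {d} → List (FSet d) → Set
FaithfullyRealizesκ {d} bs =
  ∀ (α β : FSet d) → InC bs α → InC bs β →
  (k l : Vtx d → ℚ) →
  (∀ a → a ∈ α → 0ℚ < k a) → (∀ b → b ∈ β → 0ℚ < l b) →
  lincomb k α ≡ lincomb l β →
  α ≈ β × (∀ a → a ∈ α → k a ≡ l a)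

-- Building sets.  B ⊆ C, and every B_{α_i} is a building set of P(α_i).

record IsBuildingSet {d} (bs : List (FSet d)) (B : List (FSet d)) : Set where
  field
    subC     : ∀ β → β ∈F B → InC bs β
    nonempty : ∀ α → α ∈ bs → ∀ β → β ∈F B → β ⊆ α → Σ (Vtx d) (λ a → a ∈ β)
    unionB   : ∀ α → α ∈ bs → ∀ β δ → β ∈F B → δ ∈F B → β ⊆ α → δ ⊆ α →
               Σ (Vtx d) (λ a → a ∈ β × a ∈ δ) → (β List.++ δ) ∈F B
    singletons : ∀ α → α ∈ bs → ∀ a → a ∈ α → (a ∷ []) ∈F B

IsAntichain : ∀ {d} → List (FSet d) → List (FSet d) → Set
IsAntichain N A =
  All (λ β → β ∈F N) A × 2 ≤ length A ×
  AllPairs (λ β δ → ¬ (β ⊆ δ) × ¬ (δ ⊆ β)) A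

Nested : ∀ {d} → List (FSet d) → List (FSet d) → List (FSet d) → Set
Nested {d} bs B N =
  All (λ β → β ∈F B) N ×
  (∀ (A : List (FSet d)) → IsAntichain N A →
     InC bs (concat A) × ¬ (concat A ∈F B))

Sb : ∀ {d} → List (FSet d) → List (FSet d) → Family d
Sb {d} bs B γ = Σ (List (FSet d)) λ N → Nested bs B N × γ ≈ List.map _⁺ N

Bl : ∀ {d} → FSet d → Family d → Family d
Bl {d} α E γ =
  (E γ × ¬ (α ⊆ γ)) ⊎
  (Σ (FSet d) λ γ′ → γ ≈ ((α ⁺) ∷ γ′) × ¬ (α ⊆ γ′) × E (α List.++ γ′))

BlSeq : ∀ {d} → List (FSet d) → Family d → Family d
BlSeq []       E = E
BlSeq (β ∷ βs) E = Bl β (BlSeq βs E)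

_≐_ : ∀ {d} → Family d → Family d → Set
_≐_ {d} E F = ∀ (γ : FSet d) → (E γ → F γ) × (F γ → E γ)

module Submission where

-- Let S be the singletons of B.  A family of singletons is nested exactly when
-- its points span a face, so Sb(C,S) = C.  The other members of B are then added
-- one at a time, always a ⊆-minimal one β among those still missing, so that the
-- members of B inside β are points and every union U ∪ β given by (B1) is already
-- present.  Each addition is a stellar subdivision, Sb(C, B′ ∪ {β}) = Bl_β Sb(C, B′):
-- a nested set containing β corresponds to the nested set of B′ in which β is
-- replaced by the singletons of its points.  Faithfulness of κ_X enters only
-- through the fact that a face of C whose sum is a point a is {a}.
-- Nestedness is used in the equivalent form "every nonempty A ⊆ N none of whose
-- members contains ⋃A has ⋃A ∈ C − B"; an antichain is recovered from such an A
-- as its maximal members.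

open import Defs
open import Algebra.Structures using (IsCommutativeMonoid)
open import Data.Empty using (⊥-elim)
open import Data.Integer using (+_)
import Data.Integer as ℤ
import Data.Integer.Properties as ℤ
open import Data.List using (List; []; _∷_; _++_; [_]; concat; map; filter; length; foldr)
open import Data.List.Properties
  using (++-identityʳ; concat-map-[_]; concat-++; map-++; map-∘; map-cong; map-id; filter-notAll)
open import Data.List.Membership.Propositional using (_∈_; find; lose)
open import Data.List.Membership.Propositional.Properties
  using (∈-++⁺ˡ; ∈-++⁺ʳ; ∈-++⁻; ∈-concat⁺′; ∈-concat⁻′; ∈-filter⁺; ∈-filter⁻; ∈-map⁺; ∈-map⁻;
         ∈-deduplicate⁺; ∈-deduplicate⁻)
open import Data.List.Membership.Propositional.Properties.WithK using (unique∧set⇒bag)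
import Data.List.Membership.DecPropositional as DecMembership
open import Data.List.Relation.Binary.BagAndSetEquality using (∼bag⇒↭)
open import Data.List.Relation.Binary.Permutation.Propositional using (↭⇒↭ₛ)
import Data.List.Relation.Binary.Permutation.Setoid.Properties as Permutation
open import Data.List.Relation.Binary.Subset.Propositional using (_⊆_)
import Data.List.Relation.Binary.Subset.DecPropositional as DecSubset
open import Data.List.Relation.Binary.Subset.Propositional.Properties
  using (⊆-refl; ⊆-trans; concat⁺; filter-⊆; Any-resp-⊆; xs⊆xs++ys; xs⊆ys++xs)
import Data.List.Relation.Binary.Subset.Propositional.Properties as Subset
open import Data.List.Relation.Unary.All as All using (All; []; _∷_)
import Data.List.Relation.Unary.All.Properties as All
open import Data.List.Relation.Unary.AllPairs using (AllPairs; []; _∷_)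
import Data.List.Relation.Unary.AllPairs.Properties as AllPairs
open import Data.List.Relation.Unary.Any as Any using (here; there)
import Data.List.Relation.Unary.Any.Properties as Any
open import Data.List.Relation.Unary.Unique.DecPropositional.Properties using (deduplicate-!)
open import Data.Nat using (ℕ; zero; suc; _≤_; _<_; s≤s; z≤n)
import Data.Nat as ℕ
import Data.Nat.Properties as ℕ
open import Data.Nat.Coprimality using (1-coprimeTo) renaming (sym to coprime-sym)
open import Data.Product as Product using (Σ; _×_; _,_; proj₁; proj₂)
open import Data.Rational using (ℚ; 0ℚ; 1ℚ; mkℚ)
import Data.Rational as ℚ
import Data.Rational.Properties as ℚ
open import Data.Sum using (inj₁; inj₂)
open import Data.Vec using (Vec; []; _∷_; zipWith; replicate)
import Data.Vec as Vec
open import Data.Vec.Properties using (≡-dec; zipWith-assoc; zipWith-comm; zipWith-identityˡ; zipWith-identityʳ)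
open import Function using (_∘_)
open import Function.Bundles using (mk⇔)
open import Relation.Binary.Definitions using (DecidableEquality)
open import Relation.Binary.PropositionalEquality
  using (_≡_; _≢_; refl; sym; trans; cong; cong₂; subst; subst₂; setoid; module ≡-Reasoning)
open import Relation.Binary.PropositionalEquality.Algebra using (isMagma)
open import Relation.Nullary using (¬_; Dec; yes; no; ¬?; _×-dec_)
open import Relation.Nullary.Decidable using (decidable-stable)

ℕtoℚ-+ : ∀ m n → ℕtoℚ (m ℕ.+ n) ≡ ℕtoℚ m ℚ.+ ℕtoℚ n
ℕtoℚ-+ m n = sym (begin
  ℕtoℚ m ℚ.+ ℕtoℚ n                         ≡⟨ cong₂ ℚ._+_ (ℕtoℚ≡mkℚ m) (ℕtoℚ≡mkℚ n) ⟩
  (+ m ℤ.* + 1 ℤ.+ + n ℤ.* + 1) ℚ./ 1       ≡⟨ ℚ./-cong {q₁ = 1} {q₂ = 1}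
                                                 (cong₂ ℤ._+_ (ℤ.*-identityʳ (+ m)) (ℤ.*-identityʳ (+ n))) refl ⟩
  ℕtoℚ (m ℕ.+ n)                            ∎)
  where
  open ≡-Reasoning
  ℕtoℚ≡mkℚ : ∀ k → ℕtoℚ k ≡ mkℚ (+ k) 0 (coprime-sym (1-coprimeTo k))
  ℕtoℚ≡mkℚ k = ℚ.normalize-coprime (coprime-sym (1-coprimeTo k))

κ-replicate : ∀ {k} → κ (replicate k 0) ≡ replicate k 0ℚ
κ-replicate {zero}  = refl
κ-replicate {suc k} = cong (0ℚ ∷_) κ-replicate

κ-⊕ : ∀ {k} (u v : Vtx k) → κ (u ⊕ v) ≡ zipWith ℚ._+_ (κ u) (κ v)
κ-⊕ []      []      = refl
κ-⊕ (x ∷ u) (y ∷ v) = cong₂ _∷_ (ℕtoℚ-+ x y) (κ-⊕ u v)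

module _ {d : ℕ} where

  _≟ᵥ_ : DecidableEquality (Vtx d)
  _≟ᵥ_ = ≡-dec ℕ._≟_

  _⊆?_ : (α β : FSet d) → Dec (α ⊆ β)
  _⊆?_ = DecSubset._⊆?_ _≟ᵥ_

  _≈?_ : (α β : FSet d) → Dec (α ≈ β)
  α ≈? β = (α ⊆? β) ×-dec (β ⊆? α)

  _∈F?_ : (γ : FSet d) (B : List (FSet d)) → Dec (γ ∈F B)
  γ ∈F? B = Any.any? (γ ≈?_) B

  ≈-refl : {α : FSet d} → α ≈ α
  ≈-refl = ⊆-refl , ⊆-refl

  ≈-reflexive : {α β : FSet d} → α ≡ β → α ≈ β
  ≈-reflexive refl = ≈-refl

  ≈-sym : {α β : FSet d} → α ≈ β → β ≈ α
  ≈-sym (p , q) = q , p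

  ≈-trans : {α β γ : FSet d} → α ≈ β → β ≈ γ → α ≈ γ
  ≈-trans (p , q) (p′ , q′) = ⊆-trans p p′ , ⊆-trans q′ q

  ∈F-resp-≈ : {γ γ′ : FSet d} {B : List (FSet d)} → γ ≈ γ′ → γ ∈F B → γ′ ∈F B
  ∈F-resp-≈ e = Any.map (≈-trans (≈-sym e))

  ∈⇒∈F : {γ : FSet d} {B : List (FSet d)} → γ ∈ B → γ ∈F B
  ∈⇒∈F γ∈B = lose γ∈B ≈-refl

  ∈F-trans : {δ : FSet d} {N B : List (FSet d)} → All (_∈F B) N → δ ∈F N → δ ∈F B
  ∈F-trans N⊆B δ∈N = let (δ′ , δ′∈N , δ≈δ′) = find δ∈N in ∈F-resp-≈ (≈-sym δ≈δ′) (All.lookup N⊆B δ′∈N)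

  ∈F-∷-≉ : {δ β : FSet d} {N : List (FSet d)} → δ ∈F (β ∷ N) → ¬ (δ ≈ β) → δ ∈F N
  ∈F-∷-≉ (here δ≈β)  δ≉β = ⊥-elim (δ≉β δ≈β)
  ∈F-∷-≉ (there δ∈N) _   = δ∈N

  ∈F-split : {δ β : FSet d} {R : List (FSet d)} → δ ∈F R → δ ∈F (β ∷ filter (λ ε → ¬? (ε ≈? β)) R)
  ∈F-split {β = β} {R} δ∈R with find δ∈R
  ... | ε , ε∈R , δ≈ε with ε ≈? β
  ...   | yes ε≈β = here (≈-trans δ≈ε ε≈β)
  ...   | no ε≉β  = there (lose (∈-filter⁺ (λ ε → ¬? (ε ≈? β)) ε∈R ε≉β) δ≈ε)

  InC-anti-mono : {bs : List (FSet d)} {γ γ′ : FSet d} → γ ⊆ γ′ → InC bs γ′ → InC bs γ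
  InC-anti-mono γ⊆γ′ = Any.map (⊆-trans γ⊆γ′)

  InC-[] : {bs : List (FSet d)} → bs ≢ [] → InC bs []
  InC-[] {[]}    bs≢[] = ⊥-elim (bs≢[] refl)
  InC-[] {_ ∷ _} _     = here (λ ())

  ⊆-concat : {A : List (FSet d)} {δ : FSet d} → δ ∈ A → δ ⊆ concat A
  ⊆-concat δ∈A x∈δ = ∈-concat⁺′ x∈δ δ∈A

  ⊕-isCommutativeMonoid : IsCommutativeMonoid _≡_ (_⊕_ {d}) (replicate d 0)
  ⊕-isCommutativeMonoid = record
    { isMonoid = record
      { isSemigroup = record { isMagma = isMagma _⊕_ ; assoc = zipWith-assoc ℕ.+-assoc }
      ; identity    = zipWith-identityˡ ℕ.+-identityˡ , zipWith-identityʳ ℕ.+-identityʳ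
      }
    ; comm = zipWith-comm ℕ.+-comm
    }

  ⁺-cong : {α β : FSet d} → α ≈ β → α ⁺ ≡ β ⁺
  ⁺-cong {α} {β} (α⊆β , β⊆α) =
    Permutation.foldr-commMonoid (setoid (Vtx d)) ⊕-isCommutativeMonoid (↭⇒↭ₛ (∼bag⇒↭
      (unique∧set⇒bag (deduplicate-! _≟ᵥ_ α) (deduplicate-! _≟ᵥ_ β) (mk⇔
        (λ a∈α → ∈-deduplicate⁺ _≟ᵥ_ (α⊆β (∈-deduplicate⁻ _≟ᵥ_ α a∈α)))
        (λ a∈β → ∈-deduplicate⁺ _≟ᵥ_ (β⊆α (∈-deduplicate⁻ _≟ᵥ_ β a∈β)))))))

  ⁺-singleton : (a : Vtx d) → [ a ] ⁺ ≡ a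
  ⁺-singleton = zipWith-identityʳ ℕ.+-identityʳ

  sums-split : {β : FSet d} {N : List (FSet d)} → β ∈F N →
               map _⁺ N ≈ (β ⁺ ∷ map _⁺ (filter (λ δ → ¬? (δ ≈? β)) N))
  sums-split {β} {N} β∈N = to , from
    where
    to : map _⁺ N ⊆ (β ⁺ ∷ map _⁺ (filter (λ δ → ¬? (δ ≈? β)) N))
    to c∈ with ∈-map⁻ _⁺ c∈
    ... | δ , δ∈N , refl with δ ≈? β
    ...   | yes δ≈β = here (⁺-cong δ≈β)
    ...   | no δ≉β  = there (∈-map⁺ _⁺ (∈-filter⁺ (λ δ → ¬? (δ ≈? β)) δ∈N δ≉β))
    from : (β ⁺ ∷ map _⁺ (filter (λ δ → ¬? (δ ≈? β)) N)) ⊆ map _⁺ N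
    from (here refl) = let (δ , δ∈N , β≈δ) = find β∈N in subst (_∈ _) (⁺-cong (≈-sym β≈δ)) (∈-map⁺ _⁺ δ∈N)
    from (there c∈)  = Subset.map⁺ _⁺ (filter-⊆ (λ δ → ¬? (δ ≈? β)) N) c∈

  Singleton : FSet d → Set
  Singleton δ = Σ (Vtx d) λ a → δ ≈ [ a ]

  Singleton-resp-≈ : {δ ε : FSet d} → δ ≈ ε → Singleton δ → Singleton ε
  Singleton-resp-≈ δ≈ε (a , δ≈a) = a , ≈-trans (≈-sym δ≈ε) δ≈a

  singleton? : (δ : FSet d) → Dec (Singleton δ)
  singleton? []      = no λ (_ , []≈a) → Any.¬Any[] (proj₂ []≈a (here refl))
  singleton? (x ∷ δ) with (x ∷ δ) ⊆? [ x ]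
  ... | yes δ⊆x = yes (x , δ⊆x , Subset.∈-∷⁺ʳ (here refl) (λ ()))
  ... | no δ⊈x  = no λ (a , δ≈a) → δ⊈x (subst (λ b → (x ∷ δ) ⊆ [ b ])
                                               (sym (Any.singleton⁻ (proj₁ δ≈a (here refl)))) (proj₁ δ≈a))

  singleton-⊆ : {X δ : FSet d} {a : Vtx d} → Singleton X → a ∈ δ → δ ⊆ X → X ⊆ δ
  singleton-⊆ (c , X≈c) a∈δ δ⊆X x∈X with proj₁ X≈c x∈X | proj₁ X≈c (δ⊆X a∈δ)
  ... | here refl | here refl = a∈δ

  another-point : {δ : FSet d} {a : Vtx d} → a ∈ δ → ¬ Singleton δ → Σ (Vtx d) λ b → b ∈ δ × a ≢ b
  another-point {δ} {a} a∈δ δ-nonsingleton with Any.any? (λ b → ¬? (a ≟ᵥ b)) δ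
  ... | yes b≢a = find b≢a
  ... | no ¬b≢a = ⊥-elim (δ-nonsingleton (a , δ⊆a , Subset.∈-∷⁺ʳ a∈δ (λ ())))
    where
    δ⊆a : δ ⊆ [ a ]
    δ⊆a b∈δ = here (sym (decidable-stable (a ≟ᵥ _) (All.lookup (All.¬Any⇒All¬ δ ¬b≢a) b∈δ)))

  ⁺∈-singleton : {δ : FSet d} → Singleton δ → δ ⁺ ∈ δ
  ⁺∈-singleton (a , δ≈a) = subst (_∈ _) (sym (trans (⁺-cong δ≈a) (⁺-singleton a))) (proj₂ δ≈a (here refl))

  points : FSet d → List (FSet d)
  points = map [_]

  ∈-points⁻ : {α ε : FSet d} → ε ∈ points α → Σ (Vtx d) λ a → a ∈ α × ε ≡ [ a ]
  ∈-points⁻ = ∈-map⁻ [_]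

  ∈F-points⁻ : {α δ : FSet d} → δ ∈F points α → Σ (Vtx d) λ a → a ∈ α × δ ≈ [ a ]
  ∈F-points⁻ = find ∘ Any.map⁻

  ∈F-points++ : {α δ : FSet d} {N : List (FSet d)} → δ ∈F (points α ++ N) → ¬ (δ ∈F N) →
                Σ (Vtx d) λ a → a ∈ α × δ ≈ [ a ]
  ∈F-points++ {α} δ∈ δ∉N with Any.++⁻ (points α) δ∈
  ... | inj₁ δ∈pts = ∈F-points⁻ δ∈pts
  ... | inj₂ δ∈N   = ⊥-elim (δ∉N δ∈N)

  sums-points : (α : FSet d) → map _⁺ (points α) ≡ α
  sums-points α = trans (sym (map-∘ α)) (trans (map-cong ⁺-singleton α) (map-id α))

  point∈sums : {δ : FSet d} {N : List (FSet d)} {a : Vtx d} → δ ∈F N → δ ≈ [ a ] → a ∈ map _⁺ N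
  point∈sums {a = a} δ∈N δ≈a =
    let (δ′ , δ′∈N , δ≈δ′) = find δ∈N
    in subst (_∈ _) (trans (⁺-cong (≈-trans (≈-sym δ≈δ′) δ≈a)) (⁺-singleton a)) (∈-map⁺ _⁺ δ′∈N)

  union-absorbs-points : {α : FSet d} {N A : List (FSet d)} → All (_∈F (points α ++ N)) A →
                         (concat A ++ α) ≈ concat (α ∷ filter (_∈F? N) A)
  union-absorbs-points {α} {N} {A} A⊆ = to , from
    where
    to : concat A ++ α ⊆ α ++ concat (filter (_∈F? N) A)
    to x∈ with ∈-++⁻ (concat A) x∈
    ... | inj₂ x∈α = ∈-++⁺ˡ x∈α
    ... | inj₁ x∈A with ∈-concat⁻′ A x∈A
    ...   | δ , x∈δ , δ∈A with δ ∈F? N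
    ...     | yes δ∈N = ∈-++⁺ʳ α (⊆-concat (∈-filter⁺ (_∈F? N) δ∈A δ∈N) x∈δ)
    ...     | no δ∉N  = let (a , a∈α , δ≈a) = ∈F-points++ (All.lookup A⊆ δ∈A) δ∉N in
                        ∈-++⁺ˡ (subst (_∈ α) (sym (Any.singleton⁻ (proj₁ δ≈a x∈δ))) a∈α)
    from : α ++ concat (filter (_∈F? N) A) ⊆ concat A ++ α
    from x∈ with ∈-++⁻ α x∈
    ... | inj₁ x∈α = ∈-++⁺ʳ (concat A) x∈α
    ... | inj₂ x∈F = ∈-++⁺ˡ (concat⁺ (filter-⊆ (_∈F? N) A) x∈F)

  union-replace-by-points : {β δ₀ : FSet d} {A : List (FSet d)} → δ₀ ∈ A → δ₀ ≈ β →
                            concat A ≈ concat (filter (λ δ → ¬? (δ ≈? β)) A ++ points β)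
  union-replace-by-points {β} {δ₀} {A} δ₀∈A δ₀≈β =
    subst (concat A ≈_) (trans (cong (concat A₁ ++_) (sym (concat-map-[_] β))) (concat-++ A₁ (points β)))
          (to , from)
    where
    A₁ : List (FSet d)
    A₁ = filter (λ δ → ¬? (δ ≈? β)) A
    to : concat A ⊆ concat A₁ ++ β
    to x∈ with ∈-concat⁻′ A x∈
    ... | δ , x∈δ , δ∈A with δ ≈? β
    ...   | yes δ≈β = ∈-++⁺ʳ (concat A₁) (proj₁ δ≈β x∈δ)
    ...   | no δ≉β  = ∈-++⁺ˡ (⊆-concat (∈-filter⁺ (λ δ → ¬? (δ ≈? β)) δ∈A δ≉β) x∈δ)
    from : concat A₁ ++ β ⊆ concat A
    from x∈ with ∈-++⁻ (concat A₁) x∈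
    ... | inj₁ x∈A₁ = concat⁺ (filter-⊆ (λ δ → ¬? (δ ≈? β)) A) x∈A₁
    ... | inj₂ x∈β  = ⊆-concat δ₀∈A (proj₂ δ₀≈β x∈β)

  lincomb-1 : (α : FSet d) → lincomb (λ _ → 1ℚ) α ≡ κ (α ⁺)
  lincomb-1 α = go (dedup α)
    where
    1*-identity : ∀ {k} (w : Vec ℚ k) → Vec.map (1ℚ ℚ.*_) w ≡ w
    1*-identity []      = refl
    1*-identity (x ∷ w) = cong₂ _∷_ (ℚ.*-identityˡ x) (1*-identity w)
    go : (as : List (Vtx d)) →
         foldr (λ a acc → zipWith ℚ._+_ (Vec.map (1ℚ ℚ.*_) (κ a)) acc) (replicate d 0ℚ) as
         ≡ κ (foldr _⊕_ (replicate d 0) as)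
    go []       = sym κ-replicate
    go (a ∷ as) = trans (cong₂ (zipWith ℚ._+_) (1*-identity (κ a)) (go as)) (sym (κ-⊕ a _))

  ⁺-injective : {bs : List (FSet d)} → FaithfullyRealizesκ bs →
                {α β : FSet d} → InC bs α → InC bs β → α ⁺ ≡ β ⁺ → α ≈ β
  ⁺-injective faithful {α} {β} α∈C β∈C α⁺≡β⁺ =
    proj₁ (faithful α β α∈C β∈C (λ _ → 1ℚ) (λ _ → 1ℚ) (λ _ _ → 0<1) (λ _ _ → 0<1)
      (trans (lincomb-1 α) (trans (cong κ α⁺≡β⁺) (sym (lincomb-1 β)))))
    where
    0<1 : 0ℚ ℚ.< 1ℚ
    0<1 = ℚ.positive⁻¹ 1ℚ

  ≐-trans : {E F G : Family d} → E ≐ F → F ≐ G → E ≐ G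
  ≐-trans E≐F F≐G γ = proj₁ (F≐G γ) ∘ proj₁ (E≐F γ) , proj₂ (E≐F γ) ∘ proj₂ (F≐G γ)

  Bl-cong : (β : FSet d) {E F : Family d} → E ≐ F → Bl β E ≐ Bl β F
  Bl-cong β E≐F γ = blow (λ {γ} → proj₁ (E≐F γ)) , blow (λ {γ} → proj₂ (E≐F γ))
    where
    blow : {E F : Family d} → (∀ {γ} → E γ → F γ) → Bl β E γ → Bl β F γ
    blow E⇒F (inj₁ (γ∈E , β⊈γ))             = inj₁ (E⇒F γ∈E , β⊈γ)
    blow E⇒F (inj₂ (γ′ , γ≈ , β⊈γ′ , β∪γ′∈E)) = inj₂ (γ′ , γ≈ , β⊈γ′ , E⇒F β∪γ′∈E)

module _ {d : ℕ} where

  Incomparable : FSet d → FSet d → Set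
  Incomparable β δ = ¬ (β ⊆ δ) × ¬ (δ ⊆ β)

  Uncovered : List (FSet d) → Set
  Uncovered A = A ≢ [] × (∀ {δ} → δ ∈ A → ¬ (concat A ⊆ δ))

  Nested′ : (bs B N : List (FSet d)) → Set
  Nested′ bs B N = All (_∈F B) N ×
    (∀ A → All (_∈F N) A → Uncovered A → InC bs (concat A) × ¬ (concat A ∈F B))

  Sb′ : (bs B : List (FSet d)) → Family d
  Sb′ bs B γ = Σ (List (FSet d)) λ N → Nested′ bs B N × γ ≈ map _⁺ N

  insertMaximal : FSet d → List (FSet d) → List (FSet d)
  insertMaximal δ L with Any.any? (δ ⊆?_) L
  ... | yes _ = L
  ... | no  _ = δ ∷ filter (λ ε → ¬? (ε ⊆? δ)) L

  maximals : List (FSet d) → List (FSet d)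
  maximals = foldr insertMaximal []

  insertMaximal-⊆ : ∀ δ L → insertMaximal δ L ⊆ δ ∷ L
  insertMaximal-⊆ δ L ε∈ with Any.any? (δ ⊆?_) L
  ... | yes _ = there ε∈
  insertMaximal-⊆ δ L (here refl) | no _ = here refl
  insertMaximal-⊆ δ L (there ε∈) | no _ = there (filter-⊆ (λ ε → ¬? (ε ⊆? δ)) L ε∈)

  insertMaximal-antichain : ∀ δ L → AllPairs Incomparable L → AllPairs Incomparable (insertMaximal δ L)
  insertMaximal-antichain δ L L! with Any.any? (δ ⊆?_) L
  ... | yes _ = L!
  ... | no δ⊈L = All.tabulate incomparable ∷ AllPairs.filter⁺ _ L!
    where
    incomparable : ∀ {ε} → ε ∈ filter (λ ε → ¬? (ε ⊆? δ)) L → Incomparable δ ε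
    incomparable ε∈ with ∈-filter⁻ (λ ε → ¬? (ε ⊆? δ)) ε∈
    ... | ε∈L , ε⊈δ = (λ δ⊆ε → δ⊈L (lose ε∈L δ⊆ε)) , ε⊈δ

  concat-insertMaximal : ∀ δ L → δ ++ concat L ⊆ concat (insertMaximal δ L)
  concat-insertMaximal δ L x∈ with Any.any? (δ ⊆?_) L | ∈-++⁻ δ x∈
  ... | yes _     | inj₂ x∈L = x∈L
  ... | yes δ⊆L   | inj₁ x∈δ = let (ε , ε∈L , δ⊆ε) = find δ⊆L in ⊆-concat ε∈L (δ⊆ε x∈δ)
  ... | no _      | inj₁ x∈δ = ∈-++⁺ˡ x∈δ
  ... | no _      | inj₂ x∈L with ∈-concat⁻′ L x∈L
  ...   | ε , x∈ε , ε∈L with ε ⊆? δ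
  ...     | yes ε⊆δ = ∈-++⁺ˡ (ε⊆δ x∈ε)
  ...     | no ε⊈δ  = ∈-++⁺ʳ δ (⊆-concat (∈-filter⁺ (λ ε → ¬? (ε ⊆? δ)) ε∈L ε⊈δ) x∈ε)

  maximals-⊆ : ∀ A → maximals A ⊆ A
  maximals-⊆ (δ ∷ A) ε∈ with insertMaximal-⊆ δ (maximals A) ε∈
  ... | here ε≡δ = here ε≡δ
  ... | there ε∈ = there (maximals-⊆ A ε∈)

  maximals-antichain : ∀ A → AllPairs Incomparable (maximals A)
  maximals-antichain []      = []
  maximals-antichain (δ ∷ A) = insertMaximal-antichain δ (maximals A) (maximals-antichain A)

  concat-maximals : ∀ A → concat A ⊆ concat (maximals A)
  concat-maximals (δ ∷ A) x∈ with ∈-++⁻ δ x∈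
  ... | inj₁ x∈δ = concat-insertMaximal δ (maximals A) (∈-++⁺ˡ x∈δ)
  ... | inj₂ x∈A = concat-insertMaximal δ (maximals A) (∈-++⁺ʳ δ (concat-maximals A x∈A))

  Uncovered-⊆ : {A A′ : List (FSet d)} → Uncovered A → A′ ⊆ A → concat A ⊆ concat A′ → Uncovered A′
  Uncovered-⊆ {[]}    ([]≢[] , _)     _    _     = ⊥-elim ([]≢[] refl)
  Uncovered-⊆ {_ ∷ _} {[]} (_ , uncovered) _  A⊆[]  =
    ⊥-elim (uncovered (here refl) (λ x∈ → ⊥-elim (Any.¬Any[] (A⊆[] x∈))))
  Uncovered-⊆ {_ ∷ _} {_ ∷ _} (_ , uncovered) A′⊆A A⊆A′ =
    (λ ()) , λ ε∈A′ A′⊆ε → uncovered (A′⊆A ε∈A′) (⊆-trans A⊆A′ A′⊆ε)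

  Uncovered⇒2≤length : {A : List (FSet d)} → Uncovered A → 2 ≤ length A
  Uncovered⇒2≤length {[]}            ([]≢[] , _)   = ⊥-elim ([]≢[] refl)
  Uncovered⇒2≤length {δ ∷ []}        (_ , uncovered) =
    ⊥-elim (uncovered (here refl) (subst (_⊆ δ) (sym (++-identityʳ δ)) ⊆-refl))
  Uncovered⇒2≤length {_ ∷ _ ∷ _}     _               = s≤s (s≤s z≤n)

  antichain⇒Uncovered : {A : List (FSet d)} → AllPairs Incomparable A → 2 ≤ length A → Uncovered A
  antichain⇒Uncovered {[]}    _  ()
  antichain⇒Uncovered {A@(_ ∷ _)} A! 2≤|A| = (λ ()) , λ δ∈A A⊆δ →
    let (ε , ε∈A , ε⊈δ) = another A! 2≤|A| δ∈A in ε⊈δ (⊆-trans (⊆-concat ε∈A) A⊆δ)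
    where
    another : ∀ {A δ} → AllPairs Incomparable A → 2 ≤ length A → δ ∈ A →
              Σ (FSet d) λ ε → ε ∈ A × ¬ (ε ⊆ δ)
    another {_ ∷ ε ∷ _} (δ# ∷ _) _ (here refl) = ε , there (here refl) , proj₂ (All.head δ#)
    another {_ ∷ []}    _        (s≤s ()) (here refl)
    another {ε ∷ _}     (ε# ∷ _) _ (there δ∈) = ε , here refl , proj₁ (All.lookup ε# δ∈)

  points-uncovered : {α : FSet d} {a₁ a₂ : Vtx d} → a₁ ∈ α → a₂ ∈ α → a₁ ≢ a₂ → Uncovered (points α)
  points-uncovered {_ ∷ _} a₁∈α a₂∈α a₁≢a₂ = (λ ()) , λ ε∈ α⊆ε →
    let (a , _ , ε≡a) = ∈-points⁻ ε∈
        α⊆a = subst₂ _⊆_ (concat-map-[_] _) ε≡a α⊆ε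
    in a₁≢a₂ (trans (Any.singleton⁻ (α⊆a a₁∈α)) (sym (Any.singleton⁻ (α⊆a a₂∈α))))

  Nested′-anti-mono : {bs B N N′ : List (FSet d)} → N′ ⊆ N → Nested′ bs B N → Nested′ bs B N′
  Nested′-anti-mono N′⊆N (N⊆B , nested) =
    All.anti-mono N′⊆N N⊆B , λ A A⊆N′ → nested A (All.map (Any-resp-⊆ N′⊆N) A⊆N′)

  Sb′-cong : (bs : List (FSet d)) {B₁ B₂ : List (FSet d)} →
             (∀ {δ} → δ ∈F B₁ → δ ∈F B₂) → (∀ {δ} → δ ∈F B₂ → δ ∈F B₁) → Sb′ bs B₁ ≐ Sb′ bs B₂
  Sb′-cong bs B₁⊆B₂ B₂⊆B₁ γ = transfer B₁⊆B₂ B₂⊆B₁ , transfer B₂⊆B₁ B₁⊆B₂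
    where
    transfer : {B B′ : List (FSet d)} → (∀ {δ} → δ ∈F B → δ ∈F B′) → (∀ {δ} → δ ∈F B′ → δ ∈F B) →
               Sb′ bs B γ → Sb′ bs B′ γ
    transfer B⊆B′ B′⊆B (N , (N⊆B , nested) , γ≈N⁺) =
      N , (All.map B⊆B′ N⊆B , λ A A⊆N A-unc → Product.map₂ (_∘ B′⊆B) (nested A A⊆N A-unc)) , γ≈N⁺

  union-nested∈C : {bs B : List (FSet d)} → bs ≢ [] → (∀ {δ} → δ ∈F B → InC bs δ) →
                   ∀ {N} → Nested′ bs B N → InC bs (concat N)
  union-nested∈C bs≢[] _ {[]} _ = InC-[] bs≢[]
  union-nested∈C _ B⊆C {N@(_ ∷ _)} (N⊆B , nested) with Any.any? (λ δ → concat N ⊆? δ) N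
  ... | yes covered = let (δ , δ∈N , N⊆δ) = find covered in InC-anti-mono N⊆δ (B⊆C (All.lookup N⊆B δ∈N))
  ... | no uncovered =
        proj₁ (nested N (All.tabulate ∈⇒∈F) ((λ ()) , λ δ∈N N⊆δ → uncovered (lose δ∈N N⊆δ)))

  Sb′-singletons≐C : {bs S : List (FSet d)} → bs ≢ [] →
                     (∀ {δ} → δ ∈F S → InC bs δ) → (∀ {δ} → δ ∈F S → Singleton δ) →
                     (∀ {γ a} → InC bs γ → a ∈ γ → [ a ] ∈F S) → Sb′ bs S ≐ InC bs
  Sb′-singletons≐C {bs} {S} bs≢[] S⊆C S-singletons vertices∈S γ = to , from
    where
    to : Sb′ bs S γ → InC bs γ
    to (N , N-nested@(N⊆S , _) , γ≈N⁺) =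
      InC-anti-mono (⊆-trans (proj₁ γ≈N⁺) N⁺⊆N) (union-nested∈C bs≢[] S⊆C N-nested)
      where
      N⁺⊆N : map _⁺ N ⊆ concat N
      N⁺⊆N c∈ with ∈-map⁻ _⁺ c∈
      ... | δ , δ∈N , refl = ⊆-concat δ∈N (⁺∈-singleton (S-singletons (All.lookup N⊆S δ∈N)))

    from : InC bs γ → Sb′ bs S γ
    from γ∈C = points γ , (points⊆S , nested) , ≈-reflexive (sym (sums-points γ))
      where
      points⊆S : All (_∈F S) (points γ)
      points⊆S = All.tabulate λ ε∈ → let (a , a∈γ , ε≡a) = ∈-points⁻ ε∈ in
                                     subst (_∈F S) (sym ε≡a) (vertices∈S γ∈C a∈γ)
      nested : ∀ A → All (_∈F points γ) A → Uncovered A → InC bs (concat A) × ¬ (concat A ∈F S)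
      nested []      _  ([]≢[] , _)      = ⊥-elim ([]≢[] refl)
      nested (δ ∷ A) A⊆ (_ , uncovered) =
        InC-anti-mono A⊆γ γ∈C ,
        λ A∈S → let (a , _ , δ≈a) = ∈F-points⁻ (All.head A⊆) in
                uncovered (here refl)
                  (singleton-⊆ (S-singletons A∈S) (proj₂ δ≈a (here refl)) (⊆-concat {A = δ ∷ A} (here refl)))
        where
        A⊆γ : concat (δ ∷ A) ⊆ γ
        A⊆γ x∈ with ∈-concat⁻′ (δ ∷ A) x∈
        ... | ε , x∈ε , ε∈A with ∈F-points⁻ (All.lookup A⊆ ε∈A)
        ...   | a , a∈γ , ε≈a = subst (_∈ γ) (sym (Any.singleton⁻ (proj₁ ε≈a x∈ε))) a∈γ

  module _ (bs B : List (FSet d)) where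

    Nested⇒Nested′ : ∀ {N} → Nested bs B N → Nested′ bs B N
    Nested⇒Nested′ (N⊆B , nested) = N⊆B , λ A A⊆N A-uncovered →
      let A′ = maximals A
          (A′∈C , A′∉B) = nested A′ (All.anti-mono (maximals-⊆ A) A⊆N ,
                                      Uncovered⇒2≤length
                                        (Uncovered-⊆ A-uncovered (maximals-⊆ A) (concat-maximals A)) ,
                                      maximals-antichain A)
      in InC-anti-mono (concat-maximals A) A′∈C ,
         λ A∈B → A′∉B (∈F-resp-≈ (concat-maximals A , concat⁺ (maximals-⊆ A)) A∈B)

    Nested′⇒Nested : ∀ {N} → Nested′ bs B N → Nested bs B N
    Nested′⇒Nested (N⊆B , nested) = N⊆B , λ A (A⊆N , 2≤|A| , A!) → nested A A⊆N (antichain⇒Uncovered A! 2≤|A|)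

    Sb≐Sb′ : Sb bs B ≐ Sb′ bs B
    Sb≐Sb′ γ = (λ (N , N-nested , γ≈N⁺) → N , Nested⇒Nested′ N-nested , γ≈N⁺)
             , (λ (N , N-nested , γ≈N⁺) → N , Nested′⇒Nested N-nested , γ≈N⁺)

module BlowUp {d : ℕ} {bs : List (FSet d)} (faithful : FaithfullyRealizesκ bs)
  {β : FSet d} {B : List (FSet d)} (β∈C : InC bs β)
  {a₁ a₂ : Vtx d} (a₁∈β : a₁ ∈ β) (a₂∈β : a₂ ∈ β) (a₁≢a₂ : a₁ ≢ a₂)
  (below-β-singleton : ∀ {δ} → δ ∈F B → δ ⊆ β → Singleton δ)
  (points-of-β∈B : ∀ {a} → a ∈ β → [ a ] ∈F B)
  (union-with-β : ∀ {U} → U ∈F B → InC bs (U ++ β) → Σ (Vtx d) (λ a → a ∈ U × a ∈ β) → (U ++ β) ∈F (β ∷ B))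
  (B⊆C : ∀ {δ} → δ ∈F B → InC bs δ)
  where

  β∷B⊆C : ∀ {δ} → δ ∈F (β ∷ B) → InC bs δ
  β∷B⊆C (here δ≈β)  = InC-anti-mono (proj₁ δ≈β) β∈C
  β∷B⊆C (there δ∈B) = B⊆C δ∈B

  sum-at-point : ∀ {δ a} → δ ∈F (β ∷ B) → a ∈ β → δ ⁺ ≡ a → δ ≈ [ a ]
  sum-at-point {a = a} δ∈ a∈β δ⁺≡a =
    ⁺-injective faithful (β∷B⊆C δ∈) (InC-anti-mono (Subset.∈-∷⁺ʳ a∈β (λ ())) β∈C)
      (trans δ⁺≡a (sym (⁺-singleton a)))

  point∈sums⇒point∈ : ∀ {N a} → All (_∈F (β ∷ B)) N → a ∈ β → a ∈ map _⁺ N → [ a ] ∈F N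
  point∈sums⇒point∈ N⊆ a∈β a∈N⁺ =
    let (δ , δ∈N , a≡δ⁺) = ∈-map⁻ _⁺ a∈N⁺
    in lose δ∈N (≈-sym (sum-at-point (All.lookup N⊆ δ∈N) a∈β (sym a≡δ⁺)))

  β⊈sums : ∀ {N N′} → Nested′ bs (β ∷ B) N → N′ ⊆ N → ¬ (β ⊆ map _⁺ N′)
  β⊈sums {N} (N⊆ , nested) N′⊆N β⊆N′⁺ =
    proj₂ (nested (points β) points⊆N (points-uncovered a₁∈β a₂∈β a₁≢a₂))
          (here (≈-reflexive (concat-map-[_] β)))
    where
    points⊆N : All (_∈F N) (points β)
    points⊆N = All.tabulate λ ε∈ → let (a , a∈β , ε≡a) = ∈-points⁻ ε∈ in
      subst (_∈F N) (sym ε≡a)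
        (Any-resp-⊆ N′⊆N (point∈sums⇒point∈ (All.anti-mono N′⊆N N⊆) a∈β (β⊆N′⁺ a∈β)))

  union≉β : ∀ {A N} → All (_∈F B) A → All (_∈F N) A → ¬ (β ⊆ map _⁺ N) → ¬ (concat A ≈ β)
  union≉β {A} {N} A⊆B A⊆N β⊈N⁺ (A⊆β , β⊆A) = β⊈N⁺ λ {b} b∈β →
    let (δ , b∈δ , δ∈A) = ∈-concat⁻′ A (β⊆A b∈β)
        (a , δ≈a) = below-β-singleton (All.lookup A⊆B δ∈A) (⊆-trans (⊆-concat δ∈A) A⊆β)
    in subst (_∈ map _⁺ N) (sym (Any.singleton⁻ (proj₁ δ≈a b∈δ))) (point∈sums (All.lookup A⊆N δ∈A) δ≈a)

  Nested′-∷⁺ : ∀ {N} → ¬ (β ⊆ map _⁺ N) → Nested′ bs B N → Nested′ bs (β ∷ B) N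
  Nested′-∷⁺ β⊈N⁺ (N⊆B , nested) = All.map there N⊆B , λ A A⊆N A-unc →
    let (A∈C , A∉B) = nested A A⊆N A-unc in
    A∈C , λ { (here A≈β)  → union≉β (All.map (∈F-trans N⊆B) A⊆N) A⊆N β⊈N⁺ A≈β
            ; (there A∈B) → A∉B A∈B }

  Nested′-∷⁻ : ∀ {N} → All (_∈F B) N → Nested′ bs (β ∷ B) N → Nested′ bs B N
  Nested′-∷⁻ N⊆B (_ , nested) = N⊆B , λ A A⊆N A-unc → Product.map₂ (_∘ there) (nested A A⊆N A-unc)

  union-through-β : ∀ {N N′ A} → Nested′ bs (β ∷ B) N → β ∈F N → N′ ⊆ N →
                    All (_∈F (points β ++ N′)) A → Uncovered A → ¬ (concat A ⊆ β) →
                    Σ (Vtx d) (λ a → a ∈ concat A × a ∈ β) → InC bs (concat A) × ¬ (concat A ∈F B)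
  union-through-β {N} {N′} {A} (_ , nested) β∈N N′⊆N A⊆M (_ , uncovered) A⊈β meets =
    InC-anti-mono A⊆A″ A″∈C ,
    λ A∈B → A″∉β∷B (∈F-resp-≈ A∪β≈A″ (union-with-β A∈B (InC-anti-mono (proj₁ A∪β≈A″) A″∈C) meets))
    where
    A″ : List (FSet d)
    A″ = β ∷ filter (_∈F? N′) A
    A∪β≈A″ : (concat A ++ β) ≈ concat A″
    A∪β≈A″ = union-absorbs-points A⊆M
    A⊆A″ : concat A ⊆ concat A″
    A⊆A″ = ⊆-trans (xs⊆xs++ys (concat A) β) (proj₁ A∪β≈A″)
    A″⊆N : All (_∈F N) A″
    A″⊆N = β∈N ∷ All.map (Any-resp-⊆ N′⊆N) (All.all-filter (_∈F? N′) A)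
    A″-uncovered : Uncovered A″
    A″-uncovered = (λ ()) , λ { (here refl) A″⊆β  → A⊈β (⊆-trans A⊆A″ A″⊆β)
                              ; (there ε∈F) A″⊆ε → uncovered (filter-⊆ (_∈F? N′) A ε∈F) (⊆-trans A⊆A″ A″⊆ε) }
    A″∈C : InC bs (concat A″)
    A″∈C = proj₁ (nested A″ A″⊆N A″-uncovered)
    A″∉β∷B : ¬ (concat A″ ∈F (β ∷ B))
    A″∉β∷B = proj₂ (nested A″ A″⊆N A″-uncovered)

  Nested′-points++ : ∀ {N N′} → Nested′ bs (β ∷ B) N → β ∈F N → N′ ⊆ N → All (_∈F B) N′ →
                     Nested′ bs B (points β ++ N′)
  Nested′-points++ {N} {N′} N-nested@(_ , nested) β∈N N′⊆N N′⊆B = M⊆B , M-nested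
    where
    M⊆B : All (_∈F B) (points β ++ N′)
    M⊆B = All.++⁺ (All.tabulate λ ε∈ → let (a , a∈β , ε≡a) = ∈-points⁻ ε∈ in
                    subst (_∈F B) (sym ε≡a) (points-of-β∈B a∈β))
                  N′⊆B
    M-nested : ∀ A → All (_∈F (points β ++ N′)) A → Uncovered A → InC bs (concat A) × ¬ (concat A ∈F B)
    M-nested A A⊆M A-unc with All.all? (_∈F? N′) A
    ... | yes A⊆N′ = Product.map₂ (_∘ there) (nested A (All.map (Any-resp-⊆ N′⊆N) A⊆N′) A-unc)
    ... | no A⊈N′ with find (All.¬All⇒Any¬ (_∈F? N′) A A⊈N′)
    ...   | δ , δ∈A , δ∉N′ with ∈F-points++ (All.lookup A⊆M δ∈A) δ∉N′ | concat A ⊆? β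
    ...     | a , a∈β , δ≈a | yes A⊆β = InC-anti-mono A⊆β β∈C , λ A∈B →
              proj₂ A-unc δ∈A (singleton-⊆ (below-β-singleton A∈B A⊆β) (proj₂ δ≈a (here refl)) (⊆-concat δ∈A))
    ...     | a , a∈β , δ≈a | no A⊈β  =
              union-through-β N-nested β∈N N′⊆N A⊆M A-unc A⊈β (a , ⊆-concat δ∈A (proj₂ δ≈a (here refl)) , a∈β)

  Sb′-∷⇒Bl : ∀ {γ} → Sb′ bs (β ∷ B) γ → Bl β (Sb′ bs B) γ
  Sb′-∷⇒Bl (N , N-nested@(N⊆ , _) , γ≈N⁺) with Any.any? (β ≈?_) N
  ... | no β∉N = inj₁ ((N , Nested′-∷⁻ N⊆B N-nested , γ≈N⁺) ,
                       λ β⊆γ → β⊈sums N-nested ⊆-refl (⊆-trans β⊆γ (proj₁ γ≈N⁺)))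
    where
    N⊆B : All (_∈F B) N
    N⊆B = All.tabulate λ δ∈N → ∈F-∷-≉ (All.lookup N⊆ δ∈N) (λ δ≈β → β∉N (lose δ∈N (≈-sym δ≈β)))
  ... | yes β∈N = inj₂ (map _⁺ N′ , ≈-trans γ≈N⁺ (sums-split β∈N) , β⊈sums N-nested N′⊆N ,
                        points β ++ N′ , Nested′-points++ N-nested β∈N N′⊆N N′⊆B ,
                        ≈-reflexive (sym (trans (map-++ _⁺ (points β) N′)
                                                (cong (_++ map _⁺ N′) (sums-points β)))))
    where
    N′ : List (FSet d)
    N′ = filter (λ δ → ¬? (δ ≈? β)) N
    N′⊆N : N′ ⊆ N
    N′⊆N = filter-⊆ (λ δ → ¬? (δ ≈? β)) N
    N′⊆B : All (_∈F B) N′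
    N′⊆B = All.tabulate λ δ∈N′ → let (δ∈N , δ≉β) = ∈-filter⁻ (λ δ → ¬? (δ ≈? β)) δ∈N′ in
                                 ∈F-∷-≉ (All.lookup N⊆ δ∈N) δ≉β

  union-with-β-member : ∀ {M N′ A δ₀} → Nested′ bs B M → β ⊆ map _⁺ M → N′ ⊆ M →
                        All (_∈F (β ∷ N′)) A → Uncovered A → δ₀ ∈ A → δ₀ ≈ β →
                        InC bs (concat A) × ¬ (concat A ∈F (β ∷ B))
  union-with-β-member {M} {N′} {A} (M⊆B , nested) β⊆M⁺ N′⊆M A⊆ (_ , uncovered) δ₀∈A δ₀≈β =
    InC-anti-mono (proj₁ A≈A*) A*∈C ,
    λ { (here A≈β)  → uncovered δ₀∈A (⊆-trans (proj₁ A≈β) (proj₂ δ₀≈β))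
      ; (there A∈B) → A*∉B (∈F-resp-≈ A≈A* A∈B) }
    where
    A₁ : List (FSet d)
    A₁ = filter (λ δ → ¬? (δ ≈? β)) A
    A* : List (FSet d)
    A* = A₁ ++ points β
    A≈A* : concat A ≈ concat A*
    A≈A* = union-replace-by-points δ₀∈A δ₀≈β
    A*⊆M : All (_∈F M) A*
    A*⊆M = All.++⁺
      (All.tabulate λ δ∈A₁ → let (δ∈A , δ≉β) = ∈-filter⁻ (λ δ → ¬? (δ ≈? β)) δ∈A₁ in
                             Any-resp-⊆ N′⊆M (∈F-∷-≉ (All.lookup A⊆ δ∈A) δ≉β))
      (All.tabulate λ ε∈ → let (a , a∈β , ε≡a) = ∈-points⁻ ε∈ in
                           subst (_∈F M) (sym ε≡a) (point∈sums⇒point∈ (All.map there M⊆B) a∈β (β⊆M⁺ a∈β)))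
    A*-covers : ∀ {ε} → ε ∈ A* → ¬ (concat A* ⊆ ε)
    A*-covers ε∈ A*⊆ε with ∈-++⁻ A₁ ε∈
    ... | inj₁ ε∈A₁  = uncovered (filter-⊆ (λ δ → ¬? (δ ≈? β)) A ε∈A₁) (⊆-trans (proj₁ A≈A*) A*⊆ε)
    ... | inj₂ ε∈pts with ∈-points⁻ ε∈pts
    ...   | a , a∈β , refl =
            uncovered δ₀∈A (⊆-trans (proj₁ A≈A*) (⊆-trans A*⊆ε (Subset.∈-∷⁺ʳ (proj₂ δ₀≈β a∈β) (λ ()))))
    A*-uncovered : Uncovered A*
    A*-uncovered =
      (λ A*≡[] → uncovered δ₀∈A λ x∈ →
                   ⊥-elim (Any.¬Any[] (subst (λ X → _ ∈ concat X) A*≡[] (proj₁ A≈A* x∈)))) ,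
      A*-covers
    A*∈C : InC bs (concat A*)
    A*∈C = proj₁ (nested A* A*⊆M A*-uncovered)
    A*∉B : ¬ (concat A* ∈F B)
    A*∉B = proj₂ (nested A* A*⊆M A*-uncovered)

  Nested′-β∷ : ∀ {M N′} → Nested′ bs B M → β ⊆ map _⁺ M → N′ ⊆ M → ¬ (β ⊆ map _⁺ N′) →
               Nested′ bs (β ∷ B) (β ∷ N′)
  Nested′-β∷ {M} {N′} M-nested β⊆M⁺ N′⊆M β⊈N′⁺ = here ≈-refl ∷ proj₁ N′-nested , nested
    where
    N′-nested : Nested′ bs (β ∷ B) N′
    N′-nested = Nested′-∷⁺ β⊈N′⁺ (Nested′-anti-mono N′⊆M M-nested)
    nested : ∀ A → All (_∈F (β ∷ N′)) A → Uncovered A → InC bs (concat A) × ¬ (concat A ∈F (β ∷ B))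
    nested A A⊆ A-unc with Any.any? (_≈? β) A
    ... | yes β∈A = let (δ₀ , δ₀∈A , δ₀≈β) = find β∈A in
                    union-with-β-member M-nested β⊆M⁺ N′⊆M A⊆ A-unc δ₀∈A δ₀≈β
    ... | no β∉A  = proj₂ N′-nested A A⊆N′ A-unc
      where
      A⊆N′ : All (_∈F N′) A
      A⊆N′ = All.tabulate λ δ∈A → ∈F-∷-≉ (All.lookup A⊆ δ∈A) (λ δ≈β → β∉A (lose δ∈A δ≈β))

  Bl⇒Sb′-∷ : ∀ {γ} → Bl β (Sb′ bs B) γ → Sb′ bs (β ∷ B) γ
  Bl⇒Sb′-∷ (inj₁ ((N , N-nested , γ≈N⁺) , β⊈γ)) =
    N , Nested′-∷⁺ (λ β⊆N⁺ → β⊈γ (⊆-trans β⊆N⁺ (proj₂ γ≈N⁺))) N-nested , γ≈N⁺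
  Bl⇒Sb′-∷ (inj₂ (γ′ , γ≈ , β⊈γ′ , M , M-nested , β∪γ′≈M⁺)) =
    β ∷ N′ ,
    Nested′-β∷ M-nested (⊆-trans (xs⊆xs++ys β γ′) (proj₁ β∪γ′≈M⁺)) N′⊆M
               (λ β⊆N′⁺ → β⊈γ′ (⊆-trans β⊆N′⁺ (proj₂ γ′≈N′⁺))) ,
    ≈-trans γ≈ (Subset.∷⁺ʳ _ (proj₁ γ′≈N′⁺) , Subset.∷⁺ʳ _ (proj₂ γ′≈N′⁺))
    where
    open DecMembership _≟ᵥ_ using (_∈?_)
    N′ : List (FSet d)
    N′ = filter (λ δ → δ ⁺ ∈? γ′) M
    N′⊆M : N′ ⊆ M
    N′⊆M = filter-⊆ (λ δ → δ ⁺ ∈? γ′) M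
    γ′≈N′⁺ : γ′ ≈ map _⁺ N′
    γ′≈N′⁺ = to , from
      where
      to : γ′ ⊆ map _⁺ N′
      to c∈γ′ with ∈-map⁻ _⁺ (proj₁ β∪γ′≈M⁺ (∈-++⁺ʳ β c∈γ′))
      ... | δ , δ∈M , refl = ∈-map⁺ _⁺ (∈-filter⁺ (λ δ → δ ⁺ ∈? γ′) δ∈M c∈γ′)
      from : map _⁺ N′ ⊆ γ′
      from c∈ with ∈-map⁻ _⁺ c∈
      ... | δ , δ∈N′ , refl = proj₂ (∈-filter⁻ (λ δ → δ ⁺ ∈? γ′) {xs = M} δ∈N′)

  Sb′-∷≐Bl : Sb′ bs (β ∷ B) ≐ Bl β (Sb′ bs B)
  Sb′-∷≐Bl γ = Sb′-∷⇒Bl , Bl⇒Sb′-∷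

module _ {d : ℕ} where

  minimal : FSet d → List (FSet d) → FSet d
  minimal x []       = x
  minimal x (y ∷ ys) with y ⊆? x
  ... | yes _ = minimal y ys
  ... | no  _ = minimal x ys

  minimal-∈ : ∀ x ys → minimal x ys ∈ x ∷ ys
  minimal-∈ x []       = here refl
  minimal-∈ x (y ∷ ys) with y ⊆? x
  ... | yes _ = there (minimal-∈ y ys)
  ... | no  _ with minimal-∈ x ys
  ...   | here m≡x  = here m≡x
  ...   | there m∈ys = there (there m∈ys)

  minimal-⊆ : ∀ x ys → minimal x ys ⊆ x
  minimal-⊆ x []       = ⊆-refl
  minimal-⊆ x (y ∷ ys) with y ⊆? x
  ... | yes y⊆x = ⊆-trans (minimal-⊆ y ys) y⊆x
  ... | no  _   = minimal-⊆ x ys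

  minimal-minimal : ∀ x ys {z} → z ∈ x ∷ ys → z ⊆ minimal x ys → minimal x ys ⊆ z
  minimal-minimal x []       (here refl) _ = ⊆-refl
  minimal-minimal x (y ∷ ys) z∈ z⊆m with y ⊆? x | z∈
  ... | yes y⊆x | here refl  = ⊆-trans (minimal-⊆ y ys) y⊆x
  ... | yes _   | there z∈   = minimal-minimal y ys z∈ z⊆m
  ... | no y⊈x  | here refl  = minimal-minimal x ys (here refl) z⊆m
  ... | no y⊈x  | there (here refl) = ⊥-elim (y⊈x (⊆-trans z⊆m (minimal-⊆ x ys)))
  ... | no _    | there (there z∈) = minimal-minimal x ys (there z∈) z⊆m

module Construction {d : ℕ} {bs B : List (FSet d)} (bs≢[] : bs ≢ []) (faithful : FaithfullyRealizesκ bs)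
                    (building : IsBuildingSet bs B) where
  open IsBuildingSet building

  Singletons : List (FSet d)
  Singletons = filter singleton? B

  NonSingletons : List (FSet d)
  NonSingletons = filter (¬? ∘ singleton?) B

  ∈-Singletons⁻ : ∀ {δ} → δ ∈F Singletons → Singleton δ
  ∈-Singletons⁻ δ∈S = let (ε , ε∈S , δ≈ε) = find δ∈S in
                     Singleton-resp-≈ (≈-sym δ≈ε) (proj₂ (∈-filter⁻ singleton? {xs = B} ε∈S))

  ∈-Singletons⁺ : ∀ {δ} → δ ∈F B → Singleton δ → δ ∈F Singletons
  ∈-Singletons⁺ δ∈B δ-singleton = let (ε , ε∈B , δ≈ε) = find δ∈B in
                                lose (∈-filter⁺ singleton? ε∈B (Singleton-resp-≈ δ≈ε δ-singleton)) δ≈ε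

  vertex∈Singletons : ∀ {γ a} → InC bs γ → a ∈ γ → [ a ] ∈F Singletons
  vertex∈Singletons γ∈C a∈γ = let (α , α∈bs , γ⊆α) = find γ∈C in
                              ∈-Singletons⁺ (singletons α α∈bs _ (γ⊆α a∈γ)) (_ , ≈-refl)

  R++Singletons⊆B : ∀ {R} → R ⊆ NonSingletons → R ++ Singletons ⊆ B
  R++Singletons⊆B {R} R⊆ δ∈ with ∈-++⁻ R δ∈
  ... | inj₁ δ∈R = filter-⊆ (¬? ∘ singleton?) B (R⊆ δ∈R)
  ... | inj₂ δ∈S = filter-⊆ singleton? B δ∈S

  B⊆NonSingletons++Singletons : ∀ {δ} → δ ∈F B → δ ∈F (NonSingletons ++ Singletons)
  B⊆NonSingletons++Singletons δ∈B with find δ∈B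
  ... | ε , ε∈B , δ≈ε with singleton? ε
  ...   | yes ε-singleton = Any.++⁺ʳ NonSingletons (lose (∈-filter⁺ singleton? ε∈B ε-singleton) δ≈ε)
  ...   | no ε-nonsingleton = Any.++⁺ˡ (lose (∈-filter⁺ (¬? ∘ singleton?) ε∈B ε-nonsingleton) δ≈ε)

  -- R lists the members still to be added; removing a minimal one keeps it upward
  -- closed, which is what puts the unions produced by (B1) back into m ∷ R′ ++ Singletons.
  UpClosed : List (FSet d) → Set
  UpClosed R = ∀ {δ ε} → δ ∈ R → ε ∈ NonSingletons → δ ⊆ ε → ε ∈F R

  module RemoveMinimal (x : FSet d) (xs : List (FSet d))
                       (R⊆ : x ∷ xs ⊆ NonSingletons) (R-up : UpClosed (x ∷ xs)) where

    m : FSet d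
    m = minimal x xs

    R′ : List (FSet d)
    R′ = filter (λ ε → ¬? (ε ≈? m)) (x ∷ xs)

    m∈R : m ∈ x ∷ xs
    m∈R = minimal-∈ x xs

    R′⊆R : R′ ⊆ x ∷ xs
    R′⊆R = filter-⊆ (λ ε → ¬? (ε ≈? m)) (x ∷ xs)

    |R′|<|R| : length R′ < length (x ∷ xs)
    |R′|<|R| = filter-notAll (λ ε → ¬? (ε ≈? m)) (x ∷ xs) (lose m∈R λ m≉m → m≉m ≈-refl)

    R′⊆NonSingletons : R′ ⊆ NonSingletons
    R′⊆NonSingletons = ⊆-trans R′⊆R R⊆

    R′-up : UpClosed R′
    R′-up δ∈R′ ε∈NS δ⊆ε with ∈-filter⁻ (λ ε → ¬? (ε ≈? m)) δ∈R′
    ... | δ∈R , δ≉m with ∈F-split (R-up δ∈R ε∈NS δ⊆ε)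
    ...   | here ε≈m   = let δ⊆m = ⊆-trans δ⊆ε (proj₁ ε≈m) in
                         ⊥-elim (δ≉m (δ⊆m , minimal-minimal x xs δ∈R δ⊆m))
    ...   | there ε∈R′ = ε∈R′

    m∈B : m ∈F B
    m∈B = ∈⇒∈F (filter-⊆ (¬? ∘ singleton?) B (R⊆ m∈R))

    m-nonsingleton : ¬ Singleton m
    m-nonsingleton = proj₂ (∈-filter⁻ (¬? ∘ singleton?) {xs = B} (R⊆ m∈R))

    m∈C : InC bs m
    m∈C = subC m m∈B

    first-point : Σ (Vtx d) (_∈ m)
    first-point = let (α , α∈bs , m⊆α) = find m∈C in nonempty α α∈bs m m∈B m⊆α

    second-point : Σ (Vtx d) λ b → b ∈ m × proj₁ first-point ≢ b
    second-point = another-point (proj₂ first-point) m-nonsingleton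

    R′++Singletons⊆B : ∀ {δ} → δ ∈F (R′ ++ Singletons) → δ ∈F B
    R′++Singletons⊆B = Any-resp-⊆ (R++Singletons⊆B R′⊆NonSingletons)

    below-m-singleton : ∀ {δ} → δ ∈F (R′ ++ Singletons) → δ ⊆ m → Singleton δ
    below-m-singleton δ∈ δ⊆m with Any.++⁻ R′ δ∈
    ... | inj₂ δ∈S  = ∈-Singletons⁻ δ∈S
    ... | inj₁ δ∈R′ with find δ∈R′
    ...   | ε , ε∈R′ , δ≈ε with ∈-filter⁻ (λ ε → ¬? (ε ≈? m)) ε∈R′
    ...     | ε∈R , ε≉m = let ε⊆m = ⊆-trans (proj₂ δ≈ε) δ⊆m in
                          ⊥-elim (ε≉m (ε⊆m , minimal-minimal x xs ε∈R ε⊆m))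

    above-m : ∀ {ε} → ε ∈F B → m ⊆ ε → ε ∈F (m ∷ R′ ++ Singletons)
    above-m {ε} ε∈B m⊆ε with singleton? ε
    ... | yes ε-singleton = there (Any.++⁺ʳ R′ (∈-Singletons⁺ ε∈B ε-singleton))
    ... | no ε-nonsingleton with find ε∈B
    ...   | ε′ , ε′∈B , ε≈ε′ =
            Any-resp-⊆ (Subset.∷⁺ʳ m (xs⊆xs++ys R′ Singletons))
              (∈F-split (∈F-resp-≈ (≈-sym ε≈ε′)
                (R-up m∈R (∈-filter⁺ (¬? ∘ singleton?) ε′∈B (ε-nonsingleton ∘ Singleton-resp-≈ (≈-sym ε≈ε′)))
                      (⊆-trans m⊆ε (proj₁ ε≈ε′)))))

    union-with-m : ∀ {U} → U ∈F (R′ ++ Singletons) → InC bs (U ++ m) → Σ (Vtx d) (λ a → a ∈ U × a ∈ m) →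
                   (U ++ m) ∈F (m ∷ R′ ++ Singletons)
    union-with-m {U} U∈ U∪m∈C meets =
      let (α , α∈bs , U∪m⊆α) = find U∪m∈C in
      above-m (unionB α α∈bs U m (R′++Singletons⊆B U∈) m∈B (⊆-trans (xs⊆xs++ys U m) U∪m⊆α)
                                                   (⊆-trans (xs⊆ys++xs m U) U∪m⊆α) meets)
              (xs⊆ys++xs m U)

    Sb′-R≐Bl-R′ : Sb′ bs ((x ∷ xs) ++ Singletons) ≐ Bl m (Sb′ bs (R′ ++ Singletons))
    Sb′-R≐Bl-R′ = ≐-trans (Sb′-cong bs split unsplit)
      (BlowUp.Sb′-∷≐Bl faithful m∈C
                       (proj₂ first-point) (proj₁ (proj₂ second-point)) (proj₂ (proj₂ second-point))
                       below-m-singleton (Any.++⁺ʳ R′ ∘ vertex∈Singletons m∈C) union-with-m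
                       (subC _ ∘ R′++Singletons⊆B))
      where
      split : ∀ {δ} → δ ∈F ((x ∷ xs) ++ Singletons) → δ ∈F (m ∷ R′ ++ Singletons)
      split δ∈ with Any.++⁻ (x ∷ xs) δ∈
      ... | inj₁ δ∈R = Any-resp-⊆ (Subset.∷⁺ʳ m (xs⊆xs++ys R′ Singletons)) (∈F-split δ∈R)
      ... | inj₂ δ∈S = there (Any.++⁺ʳ R′ δ∈S)
      unsplit : ∀ {δ} → δ ∈F (m ∷ R′ ++ Singletons) → δ ∈F ((x ∷ xs) ++ Singletons)
      unsplit = Any-resp-⊆ (Subset.∈-∷⁺ʳ (∈-++⁺ˡ m∈R) (Subset.++⁺ˡ Singletons R′⊆R))

  blowUps : ∀ n R → length R ≤ n → R ⊆ NonSingletons → UpClosed R →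
            Σ (List (FSet d)) λ βs → All (_∈F B) βs × Sb′ bs (R ++ Singletons) ≐ BlSeq βs (InC bs)
  blowUps _ [] _ _ _ =
    [] , [] ,
    Sb′-singletons≐C bs≢[] (subC _ ∘ Any-resp-⊆ (filter-⊆ singleton? B)) ∈-Singletons⁻ vertex∈Singletons
  blowUps (suc n) (x ∷ xs) |R|≤1+n R⊆ R-up =
    let open RemoveMinimal x xs R⊆ R-up
        (βs , βs⊆B , R′≐) = blowUps n R′ (ℕ.≤-pred (ℕ.≤-trans |R′|<|R| |R|≤1+n)) R′⊆NonSingletons R′-up
    in m ∷ βs , m∈B ∷ βs⊆B , ≐-trans Sb′-R≐Bl-R′ (Bl-cong m R′≐)

proposition8p2 : (n : ℕ) (bs : List (FSet (suc n))) (B : List (FSet (suc n))) →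
    IsComplexBases bs → UnionNonempty bs → UnionInT bs →
    FaithfullyRealizesκ bs → IsBuildingSet bs B →
    Σ (List (FSet (suc n))) λ βs →
      All (λ β → β ∈F B) βs × (Sb bs B ≐ BlSeq βs (InC bs))
proposition8p2 n bs B complex _ _ faithful building =
  let (βs , βs⊆B , Sb′≐BlSeq) =
        blowUps (length NonSingletons) NonSingletons ℕ.≤-refl ⊆-refl (λ _ ε∈ _ → ∈⇒∈F ε∈)
  in βs , βs⊆B ,
     ≐-trans (Sb≐Sb′ bs B)
       (≐-trans (Sb′-cong bs B⊆NonSingletons++Singletons (Any-resp-⊆ (R++Singletons⊆B ⊆-refl))) Sb′≐BlSeq)
  where open Construction (IsComplexBases.nonemptyBases complex) faithful building
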